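{- Let $x$ be a variable and let $u,v$ be $\lambda$-terms with $u \triangleright^* v$. Let $x_{[i]}$ be an occurrence of $x$ in $u$ and $x_{[j]}$ an occurrence of $x$ in $v$ such that $x_{[j]}$ is a residue of $x_{[i]}$ (with respect to the given reduction $u\triangleright^* v$). Then $Arg(x_{[i]}, u) \sqsubseteq Arg(x_{[j]}, v)$.
   Context: $\triangleright$ denotes one-step $\beta$-reduction and $\triangleright^*$ its reflexive–transitive closure. For an occurrence $x_{[i]}$ of a variable $x$ in a term $t$, $Arg(x_{[i]},t)$ (the scope of $x_{[i]}$) is the maximal list of arguments of $x_{[i]}$ in $t$, i.e. the finite sequence of terms $V=V_1,\dots,V_n$ such that $([]\ V_1\ \cdots\ V_n)$ is the applicative context of $x_{[i]}$ in $t$ (so $t$ contains the subterm $(x_{[i]}\ V_1 \cdots V_n)$, which is not itself applied to a further argument). For finite sequences of terms $U,V$, $U \sqsubseteq V$ means that some initial subsequence of $V$ is obtained from $U$ by substitutions and reductions, i.e. there is a substitution $\sigma$ such that $\sigma(U)$ reduces, componentwise, to an initial segment of $V$. -}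

module Defs where

open import Data.Nat using (ℕ; zero; suc; _+_)
open import Data.Bool using (Bool; true; false)
open import Data.Unit using (⊤)
open import Data.List using (List; []; _∷_; _++_; _∷ʳ_; map)
open import Data.Product using (Σ; _×_; ∃-syntax)
open import Relation.Binary.PropositionalEquality using (_≡_)
open import Relation.Binary.Construct.Closure.ReflexiveTransitive using (Star)
open import Data.List.Relation.Binary.Pointwise using (Pointwise)

-- Plain λ-terms use L = ⊤; marked terms (for tracking residues
-- of one distinguished occurrence) use L = Bool.
data Tm (L : Set) : Set where
  var : L → ℕ → Tm L
  lam : Tm L → Tm L
  app : Tm L → Tm L → Tm L

Term : Set
Term = Tm ⊤

MTerm : Set
MTerm = Tm Bool

rename : {L : Set} → (ℕ → ℕ) → Tm L → Tm L
rename ρ (var l n) = var l (ρ n)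
rename ρ (lam t)   = lam (rename (λ { zero → zero ; (suc n) → suc (ρ n) }) t)
rename ρ (app t s) = app (rename ρ t) (rename ρ s)

-- parallel substitution; the substitution may look at the label of the
-- occurrence it replaces (needed so that untouched variables keep labels)
Subst : Set → Set
Subst L = L → ℕ → Tm L

lift : {L : Set} → Subst L → Subst L
lift σ l zero    = var l zero
lift σ l (suc n) = rename suc (σ l n)

sub : {L : Set} → Subst L → Tm L → Tm L
sub σ (var l n) = σ l n
sub σ (lam t)   = lam (sub (lift σ) t)
sub σ (app t s) = app (sub σ t) (sub σ s)

_[_] : {L : Set} → Tm L → Tm L → Tm L
t [ a ] = sub (λ { l zero → a ; l (suc n) → var l n }) t

infix 4 _▷_ _▷*_
data _▷_ {L : Set} : Tm L → Tm L → Set where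
  β    : ∀ {t a} → app (lam t) a ▷ t [ a ]
  ξlam : ∀ {t t'} → t ▷ t' → lam t ▷ lam t'
  ξappL : ∀ {t t' a} → t ▷ t' → app t a ▷ app t' a
  ξappR : ∀ {t a a'} → a ▷ a' → app t a ▷ app t a'

_▷*_ : {L : Set} → Tm L → Tm L → Set
_▷*_ = Star _▷_

erase : {L : Set} → Tm L → Term
erase (var l n) = var _ n
erase (lam t)   = lam (erase t)
erase (app t s) = app (erase t) (erase s)

marks : MTerm → ℕ
marks (var true n)  = 1
marks (var false n) = 0
marks (lam t)       = marks t
marks (app t s)     = marks t + marks s

-- Spine t A : t is (x V₁ ⋯ Vₙ) with x a marked occurrence and A = V₁,…,Vₙ
data Spine : MTerm → List Term → Set where
  spine-var : ∀ {n} → Spine (var true n) []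
  spine-app : ∀ {t a A} → Spine t A → Spine (app t a) (A ∷ʳ erase a)

-- MArgs t A : t contains a marked occurrence whose scope Arg(−, t)
-- (maximal list of arguments) is A.
-- Inner t A : same, for a marked occurrence that is not the head of t's spine.
data MArgs : MTerm → List Term → Set
data Inner : MTerm → List Term → Set

data MArgs where
  head  : ∀ {t A} → Spine t A → MArgs t A
  inner : ∀ {t A} → Inner t A → MArgs t A

data Inner where
  in-lam  : ∀ {t A} → MArgs t A → Inner (lam t) A
  in-argR : ∀ {t a A} → MArgs a A → Inner (app t a) A
  in-funL : ∀ {t a A} → Inner t A → Inner (app t a) A

infix 4 _⊑_
_⊑_ : List Term → List Term → Set
U ⊑ V = Σ (ℕ → Term) λ σ → ∃[ W ] ∃[ R ]
          (V ≡ W ++ R × Pointwise (λ a b → sub (λ _ → σ) a ▷* b) U W)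

module Submission where

-- The marked occurrences of a marked term are the distinguished occurrence
-- together with its residues, since reduction copies labels.  The proof
-- traces a reduction U ▷* V BACKWARDS: if a marked occurrence of V has
-- scope B, then U has a marked occurrence whose scope A satisfies A ⊑ B.
-- As U carries exactly one mark, A is the scope of the given occurrence.

open import Defs
open import Relation.Binary.PropositionalEquality hiding ([_])
open import Data.List using (List; []; _∷_; _++_; _∷ʳ_; map)
open import Data.List.Properties using (++-assoc; ++-identityʳ; map-++; map-cong)
open import Data.List.Relation.Binary.Pointwise as Pointwise using (Pointwise; []; _∷_)
open import Data.Product using (_×_; ∃-syntax; _,_)
open import Data.Sum using (_⊎_; inj₁; inj₂)
open import Data.Bool using (Bool; true)
open import Data.Nat using (ℕ; zero; suc; _≤_; s≤s; z≤n)
open import Data.Nat.Properties using (≤-trans; ≤-reflexive; ≤⇒≯; m≤m+n; m≤n+m; +-mono-≤)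
open import Data.Unit using (⊤; tt)
open import Relation.Nullary using (contradiction)
open import Relation.Binary.Construct.Closure.ReflexiveTransitive using (ε; _◅_; _◅◅_)

-- Each fusion law is stated under a pointwise hypothesis on the maps, so
-- that it can be reapplied to the lifted maps under a binder.
ren-ren : ∀ {L} {ρ₁ ρ₂ ρ₃ : ℕ → ℕ} → (∀ n → ρ₂ (ρ₁ n) ≡ ρ₃ n) →
  (t : Tm L) → rename ρ₂ (rename ρ₁ t) ≡ rename ρ₃ t
ren-ren h (var l n) = cong (var l) (h n)
ren-ren h (lam t)   = cong lam (ren-ren (λ { zero → refl ; (suc n) → cong suc (h n) }) t)
ren-ren h (app t s) = cong₂ app (ren-ren h t) (ren-ren h s)

sub-ren : ∀ {L} {ρ : ℕ → ℕ} {σ σ′ : Subst L} → (∀ l n → σ l (ρ n) ≡ σ′ l n) →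
  (t : Tm L) → sub σ (rename ρ t) ≡ sub σ′ t
sub-ren h (var l n) = h l n
sub-ren h (lam t)   = cong lam (sub-ren (λ { l zero → refl ; l (suc n) → cong (rename suc) (h l n) }) t)
sub-ren h (app t s) = cong₂ app (sub-ren h t) (sub-ren h s)

ren-sub : ∀ {L} {ρ : ℕ → ℕ} {σ σ′ : Subst L} → (∀ l n → rename ρ (σ l n) ≡ σ′ l n) →
  (t : Tm L) → rename ρ (sub σ t) ≡ sub σ′ t
ren-sub h (var l n) = h l n
ren-sub {ρ = ρ} {σ} {σ′} h (lam t) = cong lam (ren-sub lifted t)
  where
  lifted : ∀ l n → rename _ (lift σ l n) ≡ lift σ′ l n
  lifted l zero    = refl
  lifted l (suc n) = begin
    rename _ (rename suc (σ l n)) ≡⟨ ren-ren (λ _ → refl) (σ l n) ⟩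
    rename (λ k → suc (ρ k)) (σ l n) ≡⟨ ren-ren (λ _ → refl) (σ l n) ⟨
    rename suc (rename ρ (σ l n)) ≡⟨ cong (rename suc) (h l n) ⟩
    rename suc (σ′ l n) ∎
    where open ≡-Reasoning
ren-sub h (app t s) = cong₂ app (ren-sub h t) (ren-sub h s)

sub-sub : ∀ {L} {σ₁ σ₂ σ₃ : Subst L} → (∀ l n → sub σ₂ (σ₁ l n) ≡ σ₃ l n) →
  (t : Tm L) → sub σ₂ (sub σ₁ t) ≡ sub σ₃ t
sub-sub h (var l n) = h l n
sub-sub {σ₁ = σ₁} {σ₂} {σ₃} h (lam t) = cong lam (sub-sub lifted t)
  where
  lifted : ∀ l n → sub (lift σ₂) (lift σ₁ l n) ≡ lift σ₃ l n
  lifted l zero    = refl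
  lifted l (suc n) = begin
    sub (lift σ₂) (rename suc (σ₁ l n)) ≡⟨ sub-ren (λ _ _ → refl) (σ₁ l n) ⟩
    sub (λ l k → rename suc (σ₂ l k)) (σ₁ l n) ≡⟨ ren-sub (λ _ _ → refl) (σ₁ l n) ⟨
    rename suc (sub σ₂ (σ₁ l n)) ≡⟨ cong (rename suc) (h l n) ⟩
    rename suc (σ₃ l n) ∎
    where open ≡-Reasoning
sub-sub h (app t s) = cong₂ app (sub-sub h t) (sub-sub h s)

sub-id : ∀ {L} {σ : Subst L} → (∀ l n → σ l n ≡ var l n) → (t : Tm L) → sub σ t ≡ t
sub-id h (var l n) = h l n
sub-id h (lam t)   = cong lam (sub-id (λ { l zero → refl ; l (suc n) → cong (rename suc) (h l n) }) t)
sub-id h (app t s) = cong₂ app (sub-id h t) (sub-id h s)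

ren-as-sub : ∀ {L} {ρ : ℕ → ℕ} {σ : Subst L} → (∀ l n → var l (ρ n) ≡ σ l n) →
  (t : Tm L) → rename ρ t ≡ sub σ t
ren-as-sub h (var l n) = h l n
ren-as-sub h (lam t)   = cong lam (ren-as-sub (λ { l zero → refl ; l (suc n) → cong (rename suc) (h l n) }) t)
ren-as-sub h (app t s) = cong₂ app (ren-as-sub h t) (ren-as-sub h s)

sub-[] : ∀ {L} (σ : Subst L) (t a : Tm L) → sub σ (t [ a ]) ≡ sub (lift σ) t [ sub σ a ]
sub-[] σ t a = trans (sub-sub (λ _ _ → refl) t) (sym (sub-sub (λ
  { l zero    → refl
  ; l (suc n) → trans (sub-ren (λ _ _ → refl) (σ l n)) (sub-id (λ _ _ → refl) (σ l n)) }) t))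

sub-▷ : ∀ {L} (σ : Subst L) {t t′ : Tm L} → t ▷ t′ → sub σ t ▷ sub σ t′
sub-▷ σ (β {t} {a}) = subst (app (lam (sub (lift σ) t)) (sub σ a) ▷_) (sym (sub-[] σ t a)) β
sub-▷ σ (ξlam r)    = ξlam (sub-▷ (lift σ) r)
sub-▷ σ (ξappL r)   = ξappL (sub-▷ σ r)
sub-▷ σ (ξappR r)   = ξappR (sub-▷ σ r)

sub-▷* : ∀ {L} (σ : Subst L) {t t′ : Tm L} → t ▷* t′ → sub σ t ▷* sub σ t′
sub-▷* σ ε        = ε
sub-▷* σ (r ◅ rs) = sub-▷ σ r ◅ sub-▷* σ rs

erase-ren : ∀ {L} {ρ ρ′ : ℕ → ℕ} → (∀ n → ρ n ≡ ρ′ n) →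
  (t : Tm L) → erase (rename ρ t) ≡ rename ρ′ (erase t)
erase-ren h (var l n) = cong (var tt) (h n)
erase-ren h (lam t)   = cong lam (erase-ren (λ { zero → refl ; (suc n) → cong suc (h n) }) t)
erase-ren h (app t s) = cong₂ app (erase-ren h t) (erase-ren h s)

_erases-to_ : ∀ {L} → Subst L → Subst ⊤ → Set
σ erases-to τ = ∀ l n → erase (σ l n) ≡ τ tt n

erases-to-lift : ∀ {L} {σ : Subst L} {τ} → σ erases-to τ → lift σ erases-to lift τ
erases-to-lift h l zero    = refl
erases-to-lift {σ = σ} h l (suc n) = trans (erase-ren (λ _ → refl) (σ l n)) (cong (rename suc) (h l n))

erase-sub : ∀ {L} {σ : Subst L} {τ} → σ erases-to τ → (t : Tm L) → erase (sub σ t) ≡ sub τ (erase t)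
erase-sub h (var l n) = h l n
erase-sub h (lam t)   = cong lam (erase-sub (erases-to-lift h) t)
erase-sub h (app t s) = cong₂ app (erase-sub h t) (erase-sub h s)

erase-▷ : ∀ {L} {t t′ : Tm L} → t ▷ t′ → erase t ▷ erase t′
erase-▷ (β {t} {a}) = subst (app (lam (erase t)) (erase a) ▷_)
  (sym (erase-sub (λ { l zero → refl ; l (suc n) → refl }) t)) β
erase-▷ (ξlam r)  = ξlam (erase-▷ r)
erase-▷ (ξappL r) = ξappL (erase-▷ r)
erase-▷ (ξappR r) = ξappR (erase-▷ r)

InstRed : (ℕ → Term) → Term → Term → Set
InstRed σ a b = sub (λ _ → σ) a ▷* b

InstRed-trans : ∀ {σ₁ σ₂ a b c} → InstRed σ₁ a b → InstRed σ₂ b c →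
  InstRed (λ n → sub (λ _ → σ₂) (σ₁ n)) a c
InstRed-trans {σ₁} {σ₂} {a} r₁ r₂ =
  subst (_▷* _) (sub-sub (λ _ _ → refl) a) (sub-▷* (λ _ → σ₂) r₁ ◅◅ r₂)

Pointwise-++-split : ∀ {R : Term → Term → Set} (X Y : List Term) {Z} → Pointwise R (X ++ Y) Z →
  ∃[ Z₁ ] ∃[ Z₂ ] (Z ≡ Z₁ ++ Z₂ × Pointwise R X Z₁)
Pointwise-++-split []      Y p       = [] , _ , refl , []
Pointwise-++-split (x ∷ X) Y (r ∷ p) with Pointwise-++-split X Y p
... | Z₁ , Z₂ , refl , q = _ ∷ Z₁ , Z₂ , refl , r ∷ q

⊑-intro : ∀ {σ A B} → Pointwise (InstRed σ) A B → A ⊑ B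
⊑-intro {σ} {B = B} p = σ , B , [] , sym (++-identityʳ B) , p

⊑-refl : ∀ {A} → A ⊑ A
⊑-refl = ⊑-intro (Pointwise.refl (λ {a} → subst (_▷* a) (sym (sub-id (λ _ _ → refl) a)) ε))

⊑-trans : ∀ {A B C} → A ⊑ B → B ⊑ C → A ⊑ C
⊑-trans (σ₁ , W₁ , R₁ , refl , p₁) (σ₂ , W₂ , R₂ , refl , p₂)
  with Pointwise-++-split W₁ R₁ p₂
... | Z₁ , Z₂ , refl , q =
  (λ n → sub (λ _ → σ₂) (σ₁ n)) , Z₁ , Z₂ ++ R₂ , ++-assoc Z₁ Z₂ R₂ ,
  Pointwise.transitive (λ {a} → InstRed-trans {σ₁} {σ₂} {a}) p₁ q

⊑-++ : ∀ {A B} R → A ⊑ B → A ⊑ B ++ R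
⊑-++ R (σ , W , R′ , refl , p) = σ , W , R′ ++ R , ++-assoc W R′ R , p

▷*⇒⊑ : ∀ {A B} → Pointwise _▷*_ A B → A ⊑ B
▷*⇒⊑ p = ⊑-intro (Pointwise.map (λ {a} r → subst (_▷* _) (sym (sub-id (λ _ _ → refl) a)) r) p)

⊑-sub : (τ : Subst ⊤) (A : List Term) → A ⊑ map (sub τ) A
⊑-sub τ A = ⊑-intro (instances A)
  where
  instances : ∀ A → Pointwise (InstRed (τ tt)) A (map (sub τ) A)
  instances []      = []
  instances (a ∷ A) = ε ∷ instances A

⊑-rename : (ρ : ℕ → ℕ) (A : List Term) → A ⊑ map (rename ρ) A
⊑-rename ρ A = subst (A ⊑_) (sym (map-cong (ren-as-sub (λ _ _ → refl)) A)) (⊑-sub (λ _ n → var tt (ρ n)) A)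

Traced : MTerm → List Term → Set
Traced t B = ∃[ A ] (MArgs t A × A ⊑ B)

TracedInner : MTerm → List Term → Set
TracedInner t B = ∃[ A ] (Inner t A × A ⊑ B)

Traced-⊑ : ∀ {t B C} → Traced t B → B ⊑ C → Traced t C
Traced-⊑ (A , m , A⊑B) B⊑C = A , m , ⊑-trans A⊑B B⊑C

rename-Spine : ∀ {ρ} (s : MTerm) {B} → Spine (rename ρ s) B →
  ∃[ A ] (Spine s A × B ≡ map (rename ρ) A)
rename-Spine (var true n) spine-var = [] , spine-var , refl
rename-Spine {ρ} (app t a) (spine-app sp) with rename-Spine t sp
... | A , sp′ , refl = A ∷ʳ erase a , spine-app sp′ ,
  trans (cong (map (rename ρ) A ∷ʳ_) (erase-ren (λ _ → refl) a)) (sym (map-++ (rename ρ) A (erase a ∷ [])))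

rename-MArgs : ∀ {ρ} (s : MTerm) {B} → MArgs (rename ρ s) B → Traced s B
rename-Inner : ∀ {ρ} (s : MTerm) {B} → Inner (rename ρ s) B → TracedInner s B
rename-MArgs {ρ} s (head sp) with rename-Spine s sp
... | A , sp′ , refl = A , head sp′ , ⊑-rename ρ A
rename-MArgs s (inner i) with rename-Inner s i
... | A , i′ , A⊑B = A , inner i′ , A⊑B
rename-Inner (lam t) (in-lam m) with rename-MArgs t m
... | A , m′ , A⊑B = A , in-lam m′ , A⊑B
rename-Inner (app t a) (in-argR m) with rename-MArgs a m
... | A , m′ , A⊑B = A , in-argR m′ , A⊑B
rename-Inner (app t a) (in-funL i) with rename-Inner t i
... | A , i′ , A⊑B = A , in-funL i′ , A⊑B

Spine-var : ∀ {l m B} → Spine (var l m) B → l ≡ true × B ≡ []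
Spine-var spine-var = refl , refl

-- A scope of sub σ t either comes from a marked occurrence of t, or from
-- inside some σ l n; the latter scopes are only known to satisfy Q.
module Substitution (Q : List Term → Set) (Q-⊑ : ∀ {A B} → A ⊑ B → Q A → Q B) where

  Tame : Subst Bool → Set
  Tame σ = ∀ l n → (∃[ m ] σ l n ≡ var l m) ⊎ (∀ {B} → MArgs (σ l n) B → Q B)

  Tame-lift : ∀ {σ} → Tame σ → Tame (lift σ)
  Tame-lift h l zero = inj₁ (zero , refl)
  Tame-lift {σ} h l (suc n) with h l n
  ... | inj₁ (m , eq) = inj₁ (suc m , cong (rename suc) eq)
  ... | inj₂ q        = inj₂ (λ m → Q-of-Traced q (rename-MArgs (σ l n) m))
    where
    Q-of-Traced : ∀ {s} → (∀ {A} → MArgs s A → Q A) → ∀ {B} → Traced s B → Q B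
    Q-of-Traced q (A , m , A⊑B) = Q-⊑ A⊑B (q m)

  sub-Spine : ∀ {σ τ} (t : MTerm) {B} → Tame σ → σ erases-to τ → Spine (sub σ t) B →
    (∃[ A ] (Spine t A × B ≡ map (sub τ) A)) ⊎ Q B
  sub-Spine {σ} (var l n) {B} h e sp with h l n
  ... | inj₂ q = inj₂ (q (head sp))
  ... | inj₁ (m , eq) with Spine-var (subst (λ s → Spine s B) eq sp)
  ...   | refl , refl = inj₁ ([] , spine-var , refl)
  sub-Spine {τ = τ} (app t a) h e (spine-app sp) with sub-Spine t h e sp
  ... | inj₂ q = inj₂ (Q-⊑ (⊑-++ _ ⊑-refl) q)
  ... | inj₁ (A , sp′ , refl) = inj₁ (A ∷ʳ erase a , spine-app sp′ ,
    trans (cong (map (sub τ) A ∷ʳ_) (erase-sub e a)) (sym (map-++ (sub τ) A (erase a ∷ []))))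

  sub-MArgs : ∀ {σ τ} (t : MTerm) {B} → Tame σ → σ erases-to τ → MArgs (sub σ t) B → Traced t B ⊎ Q B
  sub-Inner : ∀ {σ τ} (t : MTerm) {B} → Tame σ → σ erases-to τ → Inner (sub σ t) B → TracedInner t B ⊎ Q B
  sub-MArgs {τ = τ} t h e (head sp) with sub-Spine t h e sp
  ... | inj₁ (A , sp′ , refl) = inj₁ (A , head sp′ , ⊑-sub τ A)
  ... | inj₂ q = inj₂ q
  sub-MArgs t h e (inner i) with sub-Inner t h e i
  ... | inj₁ (A , i′ , A⊑B) = inj₁ (A , inner i′ , A⊑B)
  ... | inj₂ q = inj₂ q
  sub-Inner {σ} (var l n) {B} h e i with h l n
  ... | inj₂ q = inj₂ (q (inner i))
  ... | inj₁ (m , eq) with subst (λ s → Inner s B) eq i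
  ...   | ()
  sub-Inner (lam t) h e (in-lam m) with sub-MArgs t (Tame-lift h) (erases-to-lift e) m
  ... | inj₁ (A , m′ , A⊑B) = inj₁ (A , in-lam m′ , A⊑B)
  ... | inj₂ q = inj₂ q
  sub-Inner (app t a) h e (in-argR m) with sub-MArgs a h e m
  ... | inj₁ (A , m′ , A⊑B) = inj₁ (A , in-argR m′ , A⊑B)
  ... | inj₂ q = inj₂ q
  sub-Inner (app t a) h e (in-funL i) with sub-Inner t h e i
  ... | inj₁ (A , i′ , A⊑B) = inj₁ (A , in-funL i′ , A⊑B)
  ... | inj₂ q = inj₂ q

β-Traced : ∀ t a {B} → MArgs (t [ a ]) B → TracedInner (app (lam t) a) B
β-Traced t a m = from-sum (sub-MArgs {τ = τ} t
  (λ { l zero → inj₂ (λ m → _ , m , ⊑-refl) ; l (suc n) → inj₁ (n , refl) })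
  (λ { l zero → refl ; l (suc n) → refl }) m)
  where
  open Substitution (Traced a) (λ A⊑B q → Traced-⊑ q A⊑B)
  τ : Subst ⊤
  τ _ zero    = erase a
  τ _ (suc n) = var tt n
  from-sum : ∀ {B} → Traced t B ⊎ Traced a B → TracedInner (app (lam t) a) B
  from-sum (inj₁ (A , m′ , A⊑B)) = A , in-funL (in-lam m′) , A⊑B
  from-sum (inj₂ (A , m′ , A⊑B)) = A , in-argR m′ , A⊑B

step-Spine : ∀ {U U′ : MTerm} {B} → U ▷ U′ → Spine U′ B →
  (∃[ A ] (Spine U A × Pointwise _▷*_ A B)) ⊎ TracedInner U B
step-Spine (β {t} {a}) sp = inj₂ (β-Traced t a (head sp))
step-Spine (ξappL {a = a} r) (spine-app sp) with step-Spine r sp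
... | inj₁ (A , sp′ , A▷*B) = inj₁ (A ∷ʳ erase a , spine-app sp′ , Pointwise.++⁺ A▷*B (ε ∷ []))
... | inj₂ (A , i , A⊑B)    = inj₂ (A , in-funL i , ⊑-++ _ A⊑B)
step-Spine (ξappR {a = a} r) (spine-app {A = A} sp) =
  inj₁ (A ∷ʳ erase a , spine-app sp , Pointwise.++⁺ (Pointwise.refl ε) ((erase-▷ r ◅ ε) ∷ []))

step-MArgs : ∀ {U U′ : MTerm} {B} → U ▷ U′ → MArgs U′ B → Traced U B
step-Inner : ∀ {U U′ : MTerm} {B} → U ▷ U′ → Inner U′ B → TracedInner U B
step-MArgs r (head sp) with step-Spine r sp
... | inj₁ (A , sp′ , A▷*B) = A , head sp′ , ▷*⇒⊑ A▷*B
... | inj₂ (A , i , A⊑B)    = A , inner i , A⊑B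
step-MArgs r (inner i) with step-Inner r i
... | A , i′ , A⊑B = A , inner i′ , A⊑B
step-Inner (β {t} {a}) i = β-Traced t a (inner i)
step-Inner (ξlam r) (in-lam m) with step-MArgs r m
... | A , m′ , A⊑B = A , in-lam m′ , A⊑B
step-Inner (ξappL r) (in-argR m) = _ , in-argR m , ⊑-refl
step-Inner (ξappL r) (in-funL i) with step-Inner r i
... | A , i′ , A⊑B = A , in-funL i′ , A⊑B
step-Inner (ξappR r) (in-argR m) with step-MArgs r m
... | A , m′ , A⊑B = A , in-argR m′ , A⊑B
step-Inner (ξappR r) (in-funL i) = _ , in-funL i , ⊑-refl

trace-back : ∀ {U V : MTerm} {B} → U ▷* V → MArgs V B → Traced U B
trace-back ε m        = _ , m , ⊑-refl
trace-back (r ◅ rs) m with trace-back rs m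
... | A , m′ , A⊑B = Traced-⊑ (step-MArgs r m′) A⊑B

Spine-marks : ∀ {t A} → Spine t A → 1 ≤ marks t
Spine-marks spine-var = s≤s z≤n
Spine-marks {app t a} (spine-app sp) = ≤-trans (Spine-marks sp) (m≤m+n (marks t) (marks a))

MArgs-marks : ∀ {t A} → MArgs t A → 1 ≤ marks t
Inner-marks : ∀ {t A} → Inner t A → 1 ≤ marks t
MArgs-marks (head sp) = Spine-marks sp
MArgs-marks (inner i) = Inner-marks i
Inner-marks (in-lam m) = MArgs-marks m
Inner-marks {app t a} (in-argR m) = ≤-trans (MArgs-marks m) (m≤n+m (marks a) (marks t))
Inner-marks {app t a} (in-funL i) = ≤-trans (Inner-marks i) (m≤m+n (marks t) (marks a))

Spine-Inner-marks : ∀ {t A A′} → Spine t A → Inner t A′ → 2 ≤ marks t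
Spine-Inner-marks (spine-app sp) (in-argR m) = +-mono-≤ (Spine-marks sp) (MArgs-marks m)
Spine-Inner-marks {app t a} (spine-app sp) (in-funL i) =
  ≤-trans (Spine-Inner-marks sp i) (m≤m+n (marks t) (marks a))

Spine-unique : ∀ {t A A′} → Spine t A → Spine t A′ → A ≡ A′
Spine-unique spine-var spine-var = refl
Spine-unique (spine-app {a = a} sp) (spine-app sp′) = cong (_∷ʳ erase a) (Spine-unique sp sp′)

MArgs-unique : ∀ {t A A′} → marks t ≤ 1 → MArgs t A → MArgs t A′ → A ≡ A′
Inner-unique : ∀ {t A A′} → marks t ≤ 1 → Inner t A → Inner t A′ → A ≡ A′
MArgs-unique ≤1 (head sp) (head sp′) = Spine-unique sp sp′
MArgs-unique ≤1 (head sp) (inner i) = contradiction (Spine-Inner-marks sp i) (≤⇒≯ ≤1)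
MArgs-unique ≤1 (inner i) (head sp) = contradiction (Spine-Inner-marks sp i) (≤⇒≯ ≤1)
MArgs-unique ≤1 (inner i) (inner i′) = Inner-unique ≤1 i i′
Inner-unique ≤1 (in-lam m) (in-lam m′) = MArgs-unique ≤1 m m′
Inner-unique {app t a} ≤1 (in-argR m) (in-argR m′) =
  MArgs-unique (≤-trans (m≤n+m (marks a) (marks t)) ≤1) m m′
Inner-unique ≤1 (in-argR m) (in-funL i) = contradiction (+-mono-≤ (Inner-marks i) (MArgs-marks m)) (≤⇒≯ ≤1)
Inner-unique ≤1 (in-funL i) (in-argR m) = contradiction (+-mono-≤ (Inner-marks i) (MArgs-marks m)) (≤⇒≯ ≤1)
Inner-unique {app t a} ≤1 (in-funL i) (in-funL i′) =
  Inner-unique (≤-trans (m≤m+n (marks t) (marks a)) ≤1) i i′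

lemma2p2 : (U V : MTerm) → marks U ≡ 1 → U ▷* V →
    (A B : List Term) → MArgs U A → MArgs V B → A ⊑ B
lemma2p2 U V one-mark U▷*V A B mA mB with trace-back U▷*V mB
... | A′ , mA′ , A′⊑B = subst (_⊑ B) (MArgs-unique (≤-reflexive one-mark) mA′ mA) A′⊑B
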